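{- For every graph $G$, the relation $\prec$ on $\mathcal{T}(G)$ is irreflexive (there is no $\psi$ with $\psi\prec\psi$) and antisymmetric (there are no $\psi_1,\psi_2$ with both $\psi_1\prec\psi_2$ and $\psi_2\prec\psi_1$). Moreover, $\prec$ is not transitive in general: there exist a graph $G$ and $\psi_1,\psi_2,\psi_3\in\mathcal{T}(G)$ with $\psi_1\prec\psi_2$ and $\psi_2\prec\psi_3$ but not $\psi_1\prec\psi_3$.
   Context: A graph $G=(V,E)$ is finite, simple and undirected. Let $\bot$ be a symbol not in $V$. A transformation on $G$ is a map $\phi : V\cup\{\bot\} \to V \cup\{\bot\}$ with $\phi(\bot)=\bot$ that is injective on $V_{\not\bot} := \{v \in V : \phi(v) \neq \bot\}$; its loss is $\mathrm{loss}(\phi)=|\{v\in V : \phi(v)=\bot\}|$. It is edge-constrained (EC) if $\{v,\phi(v)\} \in E$ for all $v \in V_{\not\bot}$, and strongly neighborhood-preserving (SNP) if for all $v_1,v_2 \in V_{\not\bot}$: $\{v_1,v_2\}\in E \Leftrightarrow \{\phi(v_1),\phi(v_2)\} \in E$. A translation is an EC and SNP transformation; $\mathcal{T}(G)$ denotes the set of translations on $G$. For $\psi_1,\psi_2\in\mathcal{T}(G)$, $\psi_1 \prec \psi_2$ iff $\mathrm{loss}(\psi_1) > \mathrm{loss}(\psi_2)$ and there exists $v\in V$ with $\psi_1(v)=\psi_2(v)$. -}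

module Defs where

open import Data.Nat using (ℕ; zero; suc; _+_; _>_)
open import Data.Fin using (Fin)
import Data.Fin as Fin
open import Data.Bool using (Bool; true; false)
open import Data.Maybe using (Maybe; just; nothing)
open import Data.Product using (_×_; ∃-syntax)
open import Relation.Binary.PropositionalEquality using (_≡_)
open import Relation.Nullary using (¬_)

record Graph : Set where
  field
    n      : ℕ
    adj    : Fin n → Fin n → Bool
    sym    : ∀ u v → adj u v ≡ adj v u
    irrefl : ∀ v → adj v v ≡ false
open Graph public

Edge : (G : Graph) → Fin (n G) → Fin (n G) → Set
Edge G u v = adj G u v ≡ true

-- A transformation: φ on V ∪ {⊥} with φ(⊥)=⊥ is determined by its
-- restriction V → V ∪ {⊥}; ⊥ is represented by 'nothing'.
Map : Graph → Set
Map G = Fin (n G) → Maybe (Fin (n G))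

InjOnDefined : (G : Graph) → Map G → Set
InjOnDefined G φ = ∀ u v w → φ u ≡ just w → φ v ≡ just w → u ≡ v

countBot : ∀ {k m} → (Fin k → Maybe (Fin m)) → ℕ
countBot {zero}  f = 0
countBot {suc k} f with f Fin.zero
... | nothing = suc (countBot (λ i → f (Fin.suc i)))
... | just _  = countBot (λ i → f (Fin.suc i))

loss : (G : Graph) → Map G → ℕ
loss G φ = countBot φ

EC : (G : Graph) → Map G → Set
EC G φ = ∀ v w → φ v ≡ just w → Edge G v w

SNP : (G : Graph) → Map G → Set
SNP G φ = ∀ v₁ v₂ w₁ w₂ → φ v₁ ≡ just w₁ → φ v₂ ≡ just w₂ →
  (Edge G v₁ v₂ → Edge G w₁ w₂) × (Edge G w₁ w₂ → Edge G v₁ v₂)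

IsTranslation : (G : Graph) → Map G → Set
IsTranslation G φ = InjOnDefined G φ × EC G φ × SNP G φ

Prec : (G : Graph) → Map G → Map G → Set
Prec G ψ₁ ψ₂ = (loss G ψ₁ > loss G ψ₂) × ∃[ v ] (ψ₁ v ≡ ψ₂ v)

-- Irreflexivity and antisymmetry only use the strict order on losses.
-- Transitivity fails because "ψ₁ and ψ₂ agree somewhere" is not transitive:
-- on the edge K₂, the nowhere-defined translation and the swap agree nowhere,
-- yet the translation sending one endpoint to the other and the other to ⊥
-- agrees with each of them at a different vertex, and its loss lies strictly
-- between theirs.
module Submission where

open import Defs
open import Data.Bool using (not; false)
open import Data.Empty using (⊥-elim)
open import Data.Fin using (Fin; zero; suc; _≟_)
open import Data.Maybe using (nothing; just)
open import Data.Maybe.Properties using (just-injective)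
open import Data.Nat using (ℕ)
open import Data.Nat.Properties using (<-irrefl; <-asym; n<1+n)
open import Data.Product using (_×_; ∃-syntax; _,_)
open import Relation.Binary.PropositionalEquality using (_≡_; _≢_; refl; trans)
  renaming (sym to ≡-sym)
open import Relation.Nullary using (¬_; yes; no)
open import Relation.Nullary.Decidable using (⌊_⌋)

Prec-irrefl : (G : Graph) (ψ : Map G) → ¬ Prec G ψ ψ
Prec-irrefl G ψ (loss-ψ<loss-ψ , _) = <-irrefl refl loss-ψ<loss-ψ

Prec-asym : (G : Graph) (ψ₁ ψ₂ : Map G) → ¬ (Prec G ψ₁ ψ₂ × Prec G ψ₂ ψ₁)
Prec-asym G ψ₁ ψ₂ ((loss₂<loss₁ , _) , (loss₁<loss₂ , _)) = <-asym loss₂<loss₁ loss₁<loss₂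

nowhere : (G : Graph) → Map G
nowhere G _ = nothing

nowhere-isTranslation : (G : Graph) → IsTranslation G (nowhere G)
nowhere-isTranslation G = (λ _ _ _ ()) , (λ _ _ ()) , (λ _ _ _ _ ())

¬Prec-nowhere-total : (G : Graph) (ψ : Map G) → (∀ v → ψ v ≢ nothing) →
                      ¬ Prec G (nowhere G) ψ
¬Prec-nowhere-total G ψ total (_ , v , nothing≡ψv) = total v (≡-sym nothing≡ψv)

complete : ℕ → Graph
complete k = record
  { n      = k
  ; adj    = λ u v → not ⌊ u ≟ v ⌋
  ; sym    = adj-sym
  ; irrefl = adj-irrefl
  }
  where
  adj-sym : ∀ (u v : Fin k) → not ⌊ u ≟ v ⌋ ≡ not ⌊ v ≟ u ⌋
  adj-sym u v with u ≟ v | v ≟ u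
  ... | yes _   | yes _   = refl
  ... | no  _   | no  _   = refl
  ... | yes u≡v | no  v≢u = ⊥-elim (v≢u (≡-sym u≡v))
  ... | no  u≢v | yes v≡u = ⊥-elim (u≢v (≡-sym v≡u))

  adj-irrefl : ∀ (v : Fin k) → not ⌊ v ≟ v ⌋ ≡ false
  adj-irrefl v with v ≟ v
  ... | yes _   = refl
  ... | no  v≢v = ⊥-elim (v≢v refl)

module _ {k : ℕ} where

  ≢⇒Edge-complete : {u v : Fin k} → u ≢ v → Edge (complete k) u v
  ≢⇒Edge-complete {u} {v} u≢v with u ≟ v
  ... | yes u≡v = ⊥-elim (u≢v u≡v)
  ... | no  _   = refl

  Edge-complete⇒≢ : {u v : Fin k} → Edge (complete k) u v → u ≢ v
  Edge-complete⇒≢ {u} {v} uv u≡v with u ≟ v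
  Edge-complete⇒≢ () u≡v | yes _
  ... | no u≢v = u≢v u≡v

  -- In a complete graph adjacency is inequality, which injective maps preserve
  -- and reflect.
  complete-isTranslation : (φ : Map (complete k)) → InjOnDefined (complete k) φ →
                           (∀ v w → φ v ≡ just w → v ≢ w) →
                           IsTranslation (complete k) φ
  complete-isTranslation φ inj fixpoint-free = inj , ec , snp
    where
    ec : EC (complete k) φ
    ec v w φv≡w = ≢⇒Edge-complete (fixpoint-free v w φv≡w)

    snp : SNP (complete k) φ
    snp v₁ v₂ w₁ w₂ φv₁≡w₁ φv₂≡w₂ = preserve , reflect
      where
      preserve : Edge (complete k) v₁ v₂ → Edge (complete k) w₁ w₂
      preserve v₁v₂ = ≢⇒Edge-complete λ { refl →
        Edge-complete⇒≢ v₁v₂ (inj v₁ v₂ w₁ φv₁≡w₁ φv₂≡w₂) }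

      reflect : Edge (complete k) w₁ w₂ → Edge (complete k) v₁ v₂
      reflect w₁w₂ = ≢⇒Edge-complete λ { refl →
        Edge-complete⇒≢ w₁w₂ (just-injective (trans (≡-sym φv₁≡w₁) φv₂≡w₂)) }

K₂ : Graph
K₂ = complete 2

half : Map K₂
half zero       = just (suc zero)
half (suc zero) = nothing

swap : Map K₂
swap zero       = just (suc zero)
swap (suc zero) = just zero

half-isTranslation : IsTranslation K₂ half
half-isTranslation = complete-isTranslation half inj fixpoint-free
  where
  inj : InjOnDefined K₂ half
  inj zero       zero _ _  _ = refl
  inj zero (suc zero) _ _ ()
  inj (suc zero) _    _ ()
  fixpoint-free : ∀ v w → half v ≡ just w → v ≢ w
  fixpoint-free zero _ refl ()
  fixpoint-free (suc zero) _ ()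

swap-isTranslation : IsTranslation K₂ swap
swap-isTranslation = complete-isTranslation swap inj fixpoint-free
  where
  inj : InjOnDefined K₂ swap
  inj zero       zero       _ _    _  = refl
  inj zero       (suc zero) _ refl ()
  inj (suc zero) zero       _ refl ()
  inj (suc zero) (suc zero) _ _    _  = refl
  fixpoint-free : ∀ v w → swap v ≡ just w → v ≢ w
  fixpoint-free zero       _ refl ()
  fixpoint-free (suc zero) _ refl ()

swap-total : ∀ v → swap v ≢ nothing
swap-total zero       ()
swap-total (suc zero) ()

proposition6 : ((G : Graph) → (ψ : Map G) → IsTranslation G ψ → ¬ Prec G ψ ψ)
    × ((G : Graph) → (ψ₁ ψ₂ : Map G) → IsTranslation G ψ₁ → IsTranslation G ψ₂ →
        ¬ (Prec G ψ₁ ψ₂ × Prec G ψ₂ ψ₁))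
    × (∃[ G ] ∃[ ψ₁ ] ∃[ ψ₂ ] ∃[ ψ₃ ]
        (IsTranslation G ψ₁ × IsTranslation G ψ₂ × IsTranslation G ψ₃
          × Prec G ψ₁ ψ₂ × Prec G ψ₂ ψ₃ × ¬ Prec G ψ₁ ψ₃))
proposition6 =
    (λ G ψ _ → Prec-irrefl G ψ)
  , (λ G ψ₁ ψ₂ _ _ → Prec-asym G ψ₁ ψ₂)
  , ( K₂ , nowhere K₂ , half , swap
    , nowhere-isTranslation K₂ , half-isTranslation , swap-isTranslation
    , (n<1+n 1 , suc zero , refl)
    , (n<1+n 0 , zero , refl)
    , ¬Prec-nowhere-total K₂ swap swap-total )
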